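{- Let $\mathcal{M}=\mathcal{M}(\Sigma,I)$ be a heap monoid. The following two maps $\partial\mathcal{M}\to\overline{\mathcal{M}}$, $\xi\mapsto\xi_V$, are asynchronous stopping times: (1) For $\xi=(\gamma_1,\gamma_2,\dots)$, let $R_\xi=\{k\ge1:\gamma_k \text{ is maximal in } \mathscr{C}\}$, and set $\xi_V=\gamma_1\cdots\gamma_n$ with $n=\min R_\xi$ if $R_\xi\neq\emptyset$, and $\xi_V=\xi$ otherwise. (2) For a fixed piece $a\in\Sigma$, set $\xi_V=\bigwedge H_a(\xi)$ where $H_a(\xi)=\{x\in L(\xi)\cap\mathcal{M}: |x|_a>0\}$ and the greatest lower bound is taken in the complete lattice $L(\xi)=\{x\in\overline{\mathcal{M}}:x\le\xi\}$ (the "first hitting time of $a$").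
   Context: Setting. $\Sigma$ finite with $|\Sigma|>1$, $I\subseteq\Sigma\times\Sigma$ symmetric irreflexive, $(\Sigma,(\Sigma\times\Sigma)\setminus I)$ connected. $\mathcal{M}(\Sigma,I)=\Sigma^*/\!\equiv$, $\equiv$ the smallest congruence containing $(ab,ba)$ for $(a,b)\in I$; heaps, empty heap $0$, $|x|_a$ the number of occurrences of $a$ in $x$; $x\le y$ iff $y=x\cdot z$. Cliques: subsets of $\Sigma$ pairwise in $I$, identified with heaps; $\mathscr{C}$ the set of all cliques (ordered by inclusion, equivalently by $\le$), $\mathfrak{C}$ non-empty ones; $\gamma\to\gamma'$ iff every $b\in\gamma'$ has $a\in\gamma$ with $(a,b)\notin I$. Non-empty heaps are uniquely $\gamma_1\cdots\gamma_n$, $\gamma_i\in\mathfrak{C}$, $\gamma_i\to\gamma_{i+1}$; padded with $0$'s, heaps are paths in $(\mathscr{C},\to)$. $\partial\mathcal{M}$: infinite sequences $(\gamma_n)$ in $\mathfrak{C}$ with $\gamma_n\to\gamma_{n+1}$; $\overline{\mathcal{M}}=\mathcal{M}\cup\partial\mathcal{M}$ ordered by $(\gamma_n)\le(\gamma'_n)$ iff $\gamma_1\cdots\gamma_n\le\gamma'_1\cdots\gamma'_n$ for all $n$; $L(\xi)$ is a complete lattice with least element $0$ and greatest element $\xi$ (known). Length $|\xi|=\infty$ for $\xi\in\partial\mathcal{M}$. An asynchronous stopping time is a map $V:\partial\mathcal{M}\to\overline{\mathcal{M}}$, $\xi\mapsto\xi_V$, such that $\xi_V\le\xi$ for all $\xi$,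 and for all $\xi,\xi'\in\partial\mathcal{M}$, $(|\xi_V|<\infty$ and $\xi_V\le\xi')$ implies $\xi'_V=\xi_V$. -}

module Defs where

open import Data.Nat using (ℕ; zero; suc; _≤_; _<_)
open import Data.Fin using (Fin)
import Data.Fin as F
open import Data.Bool using (Bool; true; false)
open import Data.List using (List; []; _∷_; _++_; map; length; filter)
open import Data.Vec using ([]; _∷_)
open import Data.Fin.Subset using (Subset; _∈_; _⊆_; ⊥; Nonempty)
open import Data.Fin.Subset.Properties using (∉⊥)
open import Data.Product using (Σ; ∃; _×_; _,_; proj₁)
open import Relation.Binary.PropositionalEquality using (_≡_; _≢_)
open import Relation.Nullary using (¬_)
open import Data.Empty using (⊥-elim)

data DepPath {k : ℕ} (I : Fin k → Fin k → Bool) : Fin k → Fin k → Set where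
  here : ∀ a → DepPath I a a
  step : ∀ a b c → I a b ≡ false → DepPath I b c → DepPath I a c

record HeapMonoid : Set where
  field
    k         : ℕ
    k>1       : 1 < k
    I         : Fin k → Fin k → Bool
    I-sym     : ∀ a b → I a b ≡ true → I b a ≡ true
    I-irrefl  : ∀ a → I a a ≡ false
    connected : ∀ a b → DepPath I a b

module _ (H : HeapMonoid) where
  open HeapMonoid H

  Σ' : Set
  Σ' = Fin k

  Word : Set
  Word = List Σ'

  data _≈_ : Word → Word → Set where
    ≈-refl  : ∀ {u} → u ≈ u
    ≈-sym   : ∀ {u v} → u ≈ v → v ≈ u
    ≈-trans : ∀ {u v w} → u ≈ v → v ≈ w → u ≈ w
    ≈-swap  : ∀ u v a b → I a b ≡ true →
              (u ++ a ∷ b ∷ v) ≈ (u ++ b ∷ a ∷ v)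

  _≤ᴹ_ : Word → Word → Set
  x ≤ᴹ y = ∃ λ z → y ≈ (x ++ z)

  occ : Σ' → Word → ℕ
  occ a [] = 0
  occ a (b ∷ w) with a F.≟ b
  ... | Relation.Nullary.yes _ = suc (occ a w)
  ... | Relation.Nullary.no  _ = occ a w

  -- Cliques (possibly empty), as subsets of Σ
  record Clique : Set where
    field
      set   : Subset k
      indep : ∀ a b → a ∈ set → b ∈ set → a ≢ b → I a b ≡ true
  open Clique public

  emptyClique : Clique
  emptyClique = record { set = ⊥ ; indep = λ a b a∈ _ _ → ⊥-elim (∉⊥ a∈) }

  _⇝_ : Clique → Clique → Set
  γ ⇝ γ' = ∀ b → b ∈ set γ' → ∃ λ a → a ∈ set γ × I a b ≡ false

  MaximalClique : Clique → Set
  MaximalClique γ = ∀ (γ' : Clique) → set γ ⊆ set γ' → set γ' ≡ set γ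

  subsetWord : ∀ {n} → Subset n → List (Fin n)
  subsetWord [] = []
  subsetWord (true ∷ p) = F.zero ∷ map F.suc (subsetWord p)
  subsetWord (false ∷ p) = map F.suc (subsetWord p)

  cliqueWord : Clique → Word
  cliqueWord γ = subsetWord (set γ)

  -- Elements of M̄ = M ∪ ∂M as paths in (𝒞 , →);  seq 0 is γ₁.
  -- Finite heaps are the paths that are eventually 0 (padding by 0).
  record MBar : Set where
    field
      seq   : ℕ → Clique
      chain : ∀ n → seq n ⇝ seq (suc n)
  open MBar public

  prefix : ℕ → MBar → Word
  prefix zero ξ = []
  prefix (suc n) ξ = prefix n ξ ++ cliqueWord (seq ξ n)

  _≤̄_ : MBar → MBar → Set
  ξ ≤̄ ξ' = ∀ n → prefix n ξ ≤ᴹ prefix n ξ'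

  _≐_ : MBar → MBar → Set
  ξ ≐ ξ' = ∀ n → set (seq ξ n) ≡ set (seq ξ' n)

  Finite : MBar → Set
  Finite ξ = ∃ λ N → ∀ m → N ≤ m → set (seq ξ m) ≡ ⊥

  Contains : Σ' → MBar → Set
  Contains a x = ∃ λ N → 0 < occ a (prefix N x)

  record ∂M : Set where
    field
      elt      : MBar
      nonempty : ∀ n → Nonempty (set (seq elt n))
  open ∂M public

  IsAST : (∂M → MBar) → Set
  IsAST V = (∀ ξ → V ξ ≤̄ elt ξ)
          × (∀ ξ ξ' → Finite (V ξ) → V ξ ≤̄ elt ξ' → V ξ' ≐ V ξ)

  truncSeq : ℕ → (ℕ → Clique) → ℕ → Clique
  truncSeq zero f i = emptyClique
  truncSeq (suc n) f zero = f zero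
  truncSeq (suc n) f (suc i) = truncSeq n (λ j → f (suc j)) i

  truncChain : ∀ n (f : ℕ → Clique) → (∀ i → f i ⇝ f (suc i)) →
               ∀ i → truncSeq n f i ⇝ truncSeq n f (suc i)
  truncChain zero f c i b b∈ = ⊥-elim (∉⊥ b∈)
  truncChain (suc zero) f c zero b b∈ = ⊥-elim (∉⊥ b∈)
  truncChain (suc (suc n)) f c zero = c zero
  truncChain (suc n) f c (suc i) = truncChain n (λ j → f (suc j)) (λ j → c (suc j)) i

  truncate : ℕ → MBar → MBar
  truncate n ξ = record { seq = truncSeq n (seq ξ) ; chain = truncChain n (seq ξ) (chain ξ) }

  -- (1) first time a maximal clique is hit:  R_ξ = {k ≥ 1 : γ_k maximal}
  -- (0-based index m corresponds to k = m + 1)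
  Spec1 : (∂M → MBar) → Set
  Spec1 V = ∀ ξ →
      (∀ m → MaximalClique (seq (elt ξ) m)
           → (∀ j → j < m → ¬ MaximalClique (seq (elt ξ) j))
           → V ξ ≐ truncate (suc m) (elt ξ))
    × ((∀ m → ¬ MaximalClique (seq (elt ξ) m)) → V ξ ≐ elt ξ)

  InH : Σ' → MBar → MBar → Set
  InH a ξ x = (x ≤̄ ξ) × Finite x × Contains a x

  IsMeetH : Σ' → MBar → MBar → Set
  IsMeetH a ξ y =
      (y ≤̄ ξ)
    × (∀ x → InH a ξ x → y ≤̄ x)
    × (∀ z → z ≤̄ ξ → (∀ x → InH a ξ x → z ≤̄ x) → z ≤̄ y)

  Spec2 : Σ' → (∂M → MBar) → Set
  Spec2 a V = ∀ ξ → IsMeetH a (elt ξ) (V ξ)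

module Submission where

-- The proof rests on the level structure of heaps.  Stacking the pieces of a
-- word one at a time, each landing just above the highest occurrence of a piece
-- it depends on, records for every piece the levels at which it occurs.  This
-- record is invariant under the trace congruence (stack-∼), and for a prefix
-- γ₁ ⋯ γₙ of a path in (𝒞 , →) it lists exactly the positions of the cliques
-- (profile-prefix).  Comparing records of γ₁ ⋯ γₙ ≤ γ'₁ ⋯ γ'ₙ shows that the
-- cliques are included levelwise (levelwise-⊆) and that a piece depending on a
-- piece at level l cannot be added at levels ≤ l (pinned); conversely a
-- commutation criterion proves inequalities (⊑-by-commutation).
-- (1): below a maximal clique every piece is pinned, so ξ' ≥ ξ_V agrees with ξ
--      up to its first maximal clique (agree-below-maximal).
-- (2): the meet of H_a(ξ) is the heap generated by the first occurrence of a
--      (HittingHeap), which is also the meet of H_a(ξ') whenever it is ≤ ξ'.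
-- Both proofs split on whether a first index exists; this case split is
-- classical but harmless since the goals are decidable (by-first-or-none).

open import Defs
open import Data.Fin using (Fin)
open import Data.Product using (_×_)

import Data.Fin as F
import Data.Fin.Properties as FP
open import Data.Nat as N using (ℕ; zero; suc; _≤_; _<_; z≤n; s≤s; _⊔_; _⊓_)
import Data.Nat.Properties as NP
open import Data.Bool using (true; false; if_then_else_)
import Data.Bool.Properties as BP
open import Data.List using (List; []; _∷_; _++_; map; [_]; filter)
import Data.List.Properties as LP
open import Data.List.Membership.Propositional using () renaming (_∈_ to _∈ₗ_; _∉_ to _∉ₗ_)
import Data.List.Membership.Propositional.Properties as LMP
open import Data.List.Relation.Unary.Any using (here; there)
open import Data.List.Relation.Unary.All as All using (All; []; _∷_)
import Data.List.Relation.Unary.All.Properties as AllP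
open import Data.List.Relation.Unary.AllPairs using ([]; _∷_; uncons)
open import Data.List.Relation.Unary.Unique.Propositional using (Unique)
import Data.List.Relation.Unary.Unique.Propositional.Properties as UniqueP
import Data.Vec.Base as V
open V using ([]; _∷_)
import Data.Vec.Properties as VP
open import Data.Vec.Functional using (updateAt)
open import Data.Vec.Functional.Properties using (updateAt-updates; updateAt-minimal)
open import Data.Fin.Subset using (Subset; _∈_; _∉_; _⊆_; ⊥; ⁅_⁆; _∪_; _∩_)
import Data.Fin.Subset.Properties as SP
open import Data.Product using (∃; _,_; proj₁; proj₂)
open import Data.Sum using (_⊎_; inj₁; inj₂)
open import Data.Empty using (⊥-elim)
open import Relation.Nullary using (¬_; Dec; yes; no; does)
open import Relation.Nullary.Decidable using (decidable-stable; _×-dec_; dec-true)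
open import Relation.Unary using (Decidable)
open import Relation.Unary.Properties using (∁?)
open import Relation.Binary.Bundles using (Setoid)
open import Relation.Binary.Definitions using (tri<; tri≈; tri>)
import Relation.Binary.Reasoning.Setoid as SetoidReasoning
open import Relation.Binary.PropositionalEquality
  using (_≡_; _≢_; refl; sym; trans; cong; cong₂; subst; subst₂; _≗_; module ≡-Reasoning)

-- Either there is a least index satisfying P, or none satisfies it.  This is
-- not constructively provable, but it is irrefutable, so it may be assumed when
-- the goal is decidable.
FirstOrNone : (ℕ → Set) → Set
FirstOrNone P = (∃ λ m → P m × (∀ j → j < m → ¬ P j)) ⊎ (∀ m → ¬ P m)

¬¬-first-or-none : ∀ P → ¬ ¬ FirstOrNone P
¬¬-first-or-none P refute = refute (inj₂ (λ m → none-below (suc m) m NP.≤-refl))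
  where
    none-below : ∀ m j → j < m → ¬ P j
    none-below (suc m) j (s≤s j≤m) Pj with NP.m≤n⇒m<n∨m≡n j≤m
    ... | inj₁ j<m = none-below m j j<m Pj
    ... | inj₂ refl = refute (inj₁ (j , Pj , none-below j))

by-first-or-none : ∀ {G : Set} P → Dec G → (FirstOrNone P → G) → G
by-first-or-none P G? cases = decidable-stable G? (λ ¬G → ¬¬-first-or-none P (λ f → ¬G (cases f)))

module _ (H : HeapMonoid) where
  open HeapMonoid H

  infix 4 _∼_

  _∼_ : Word H → Word H → Set
  _∼_ = _≈_ H

  ∼-congˡ : ∀ p {u v} → u ∼ v → p ++ u ∼ p ++ v
  ∼-congˡ p ≈-refl = ≈-refl
  ∼-congˡ p (≈-sym e) = ≈-sym (∼-congˡ p e)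
  ∼-congˡ p (≈-trans e f) = ≈-trans (∼-congˡ p e) (∼-congˡ p f)
  ∼-congˡ p (≈-swap u v a b iab) =
    subst₂ _∼_ (LP.++-assoc p u (a ∷ b ∷ v)) (LP.++-assoc p u (b ∷ a ∷ v))
      (≈-swap (p ++ u) v a b iab)

  ∼-congʳ : ∀ q {u v} → u ∼ v → u ++ q ∼ v ++ q
  ∼-congʳ q ≈-refl = ≈-refl
  ∼-congʳ q (≈-sym e) = ≈-sym (∼-congʳ q e)
  ∼-congʳ q (≈-trans e f) = ≈-trans (∼-congʳ q e) (∼-congʳ q f)
  ∼-congʳ q (≈-swap u v a b iab) =
    subst₂ _∼_ (sym (LP.++-assoc u (a ∷ b ∷ v) q)) (sym (LP.++-assoc u (b ∷ a ∷ v) q))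
      (≈-swap u (v ++ q) a b iab)

  ∼-reflexive : ∀ {u v} → u ≡ v → u ∼ v
  ∼-reflexive refl = ≈-refl

  move-front : ∀ c u v → All (λ d → I d c ≡ true) u → u ++ c ∷ v ∼ c ∷ u ++ v
  move-front c [] v [] = ≈-refl
  move-front c (d ∷ u) v (idc ∷ idcs) =
    ≈-trans (∼-congˡ [ d ] (move-front c u v idcs)) (≈-swap [] (u ++ v) d c idc)

  commute : ∀ u v → All (λ c → All (λ d → I d c ≡ true) u) v → u ++ v ∼ v ++ u
  commute u [] [] = ∼-reflexive (LP.++-identityʳ u)
  commute u (c ∷ v) (ic ∷ ics) = ≈-trans (move-front c u v ic) (∼-congˡ [ c ] (commute u v ics))

  Independent : Word H → Set
  Independent L = ∀ {c d} → c ∈ₗ L → d ∈ₗ L → c ≢ d → I c d ≡ true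

  partition : ∀ {P : Fin k → Set} (P? : Decidable P) L → Independent L →
              L ∼ filter P? L ++ filter (∁? P?) L
  partition P? [] ind = ≈-refl
  partition P? (c ∷ L) ind with P? c
  ... | yes Pc = ∼-congˡ [ c ] (partition P? L (λ m m' → ind (there m) (there m')))
  ... | no ¬Pc =
    ≈-trans (∼-congˡ [ c ] (partition P? L (λ m m' → ind (there m) (there m'))))
            (≈-sym (move-front c (filter P? L) (filter (∁? P?) L) (All.tabulate indep-c)))
    where
      indep-c : ∀ {d} → d ∈ₗ filter P? L → I d c ≡ true
      indep-c m with LMP.∈-filter⁻ P? m
      ... | m' , Pd = ind (there m') (here refl) (λ { refl → ¬Pc Pd })

  subsetWord-∈⁺ : ∀ {n} {c : Fin n} {s : Subset n} → c ∈ s → c ∈ₗ subsetWord H s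
  subsetWord-∈⁺ {c = F.zero}  {true ∷ p}  V.here = here refl
  subsetWord-∈⁺ {c = F.suc c} {true ∷ p}  (V.there c∈) = there (LMP.∈-map⁺ F.suc (subsetWord-∈⁺ c∈))
  subsetWord-∈⁺ {c = F.suc c} {false ∷ p} (V.there c∈) = LMP.∈-map⁺ F.suc (subsetWord-∈⁺ c∈)

  subsetWord-∈⁻ : ∀ {n} {c : Fin n} (s : Subset n) → c ∈ₗ subsetWord H s → c ∈ s
  subsetWord-∈⁻ (true ∷ p) (here refl) = V.here
  subsetWord-∈⁻ (true ∷ p) (there m) with LMP.∈-map⁻ F.suc m
  ... | _ , m' , refl = V.there (subsetWord-∈⁻ p m')
  subsetWord-∈⁻ (false ∷ p) m with LMP.∈-map⁻ F.suc m
  ... | _ , m' , refl = V.there (subsetWord-∈⁻ p m')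

  subsetWord-unique : ∀ {n} (s : Subset n) → Unique (subsetWord H s)
  subsetWord-unique [] = []
  subsetWord-unique (true ∷ p) =
    All.tabulate (λ m eq → let (_ , _ , e) = LMP.∈-map⁻ F.suc m in FP.0≢1+n (trans eq e))
      ∷ UniqueP.map⁺ FP.suc-injective (subsetWord-unique p)
  subsetWord-unique (false ∷ p) = UniqueP.map⁺ FP.suc-injective (subsetWord-unique p)

  subsetWord-⊥ : ∀ {n} → subsetWord H {n} ⊥ ≡ []
  subsetWord-⊥ {zero} = refl
  subsetWord-⊥ {suc n} = cong (map F.suc) (subsetWord-⊥ {n})

  filter-map-suc : ∀ {n} b (p : Subset n) l →
                   filter (SP._∈? (b ∷ p)) (map F.suc l) ≡ map F.suc (filter (SP._∈? p) l)
  filter-map-suc b p [] = refl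
  filter-map-suc b p (x ∷ l) with does (x SP.∈? p)
  ... | true = cong (F.suc x ∷_) (filter-map-suc b p l)
  ... | false = filter-map-suc b p l

  subsetWord-∩ : ∀ {n} (p q : Subset n) → filter (SP._∈? p) (subsetWord H q) ≡ subsetWord H (p ∩ q)
  subsetWord-∩ [] [] = refl
  subsetWord-∩ (true ∷ p) (true ∷ q) =
    cong (F.zero ∷_) (trans (filter-map-suc true p (subsetWord H q)) (cong (map F.suc) (subsetWord-∩ p q)))
  subsetWord-∩ (false ∷ p) (true ∷ q) =
    trans (filter-map-suc false p (subsetWord H q)) (cong (map F.suc) (subsetWord-∩ p q))
  subsetWord-∩ (true ∷ p) (false ∷ q) =
    trans (filter-map-suc true p (subsetWord H q)) (cong (map F.suc) (subsetWord-∩ p q))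
  subsetWord-∩ (false ∷ p) (false ∷ q) =
    trans (filter-map-suc false p (subsetWord H q)) (cong (map F.suc) (subsetWord-∩ p q))

  subsetWord-⊆ : ∀ {n} {p q : Subset n} → p ⊆ q → filter (SP._∈? p) (subsetWord H q) ≡ subsetWord H p
  subsetWord-⊆ {p = p} {q} p⊆q =
    trans (subsetWord-∩ p q)
          (cong (subsetWord H) (SP.⊆-antisym (SP.p∩q⊆p p q) (λ c∈p → SP.x∈p∩q⁺ (c∈p , p⊆q c∈p))))

  cliqueWord-independent : ∀ γ → Independent (cliqueWord H γ)
  cliqueWord-independent γ m m' = indep γ _ _ (subsetWord-∈⁻ (set γ) m) (subsetWord-∈⁻ (set γ) m')

  maxOver : ∀ n → (Fin n → ℕ) → ℕ
  maxOver zero f = 0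
  maxOver (suc n) f = f F.zero ⊔ maxOver n (λ i → f (F.suc i))

  maxOver-≥ : ∀ n f (i : Fin n) → f i ≤ maxOver n f
  maxOver-≥ (suc n) f F.zero = NP.m≤m⊔n _ _
  maxOver-≥ (suc n) f (F.suc i) = NP.≤-trans (maxOver-≥ n _ i) (NP.m≤n⊔m _ _)

  maxOver-lub : ∀ n f {B} → (∀ i → f i ≤ B) → maxOver n f ≤ B
  maxOver-lub zero f h = z≤n
  maxOver-lub (suc n) f h = NP.⊔-lub (h F.zero) (maxOver-lub n _ (λ i → h (F.suc i)))

  maxOver-cong : ∀ n {f g} → f ≗ g → maxOver n f ≡ maxOver n g
  maxOver-cong zero e = refl
  maxOver-cong (suc n) e = cong₂ _⊔_ (e F.zero) (maxOver-cong n (λ i → e (F.suc i)))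

  I-false-sym : ∀ a c → I a c ≡ false → I c a ≡ false
  I-false-sym a c e with I c a in eq
  ... | true = trans (sym (I-sym c a eq)) e
  ... | false = refl

  I-true⇒≢ : ∀ {a b} → I a b ≡ true → a ≢ b
  I-true⇒≢ {a} iab refl with () ← trans (sym iab) (I-irrefl a)

  -- Levels s: for each piece, the levels of its occurrences in a heap, highest first.
  -- Stacking a piece c puts it one level above every occurrence of a piece depending on c.
  Levels : Set
  Levels = Fin k → List ℕ

  empty : Levels
  empty _ = []

  next : List ℕ → ℕ
  next [] = 0
  next (j ∷ _) = suc j

  barrier : Levels → Fin k → Fin k → ℕ
  barrier s c d = if I c d then 0 else next (s d)

  landing : Levels → Fin k → ℕ
  landing s c = maxOver k (barrier s c)

  push : Levels → Fin k → Levels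
  push s c = updateAt s c (landing s c ∷_)

  stack : Levels → Word H → Levels
  stack s [] = s
  stack s (c ∷ w) = stack (push s c) w

  stack-++ : ∀ s u v → stack s (u ++ v) ≡ stack (stack s u) v
  stack-++ s [] v = refl
  stack-++ s (c ∷ u) v = stack-++ (push s c) u v

  push-at : ∀ s c → push s c c ≡ landing s c ∷ s c
  push-at s c = updateAt-updates c s

  push-other : ∀ s c d → d ≢ c → push s c d ≡ s d
  push-other s c d d≢c = updateAt-minimal d c s d≢c

  landing-≥ : ∀ s c d → I c d ≡ false → next (s d) ≤ landing s c
  landing-≥ s c d icd = NP.≤-trans (NP.≤-reflexive (sym barrier-dep)) (maxOver-≥ k _ d)
    where
      barrier-dep : barrier s c d ≡ next (s d)
      barrier-dep rewrite icd = refl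

  landing-≤ : ∀ s c {n} → (∀ d → next (s d) ≤ n) → landing s c ≤ n
  landing-≤ s c bound = maxOver-lub k _ (λ d → NP.≤-trans (barrier-≤ d) (bound d))
    where
      barrier-≤ : ∀ d → barrier s c d ≤ next (s d)
      barrier-≤ d with I c d
      ... | true = z≤n
      ... | false = NP.≤-refl

  landing-cong : ∀ {s s'} c → s ≗ s' → landing s c ≡ landing s' c
  landing-cong c e = maxOver-cong k (λ d → cong (λ l → if I c d then 0 else next l) (e d))

  landing-push : ∀ s a c → I c a ≡ true → landing (push s a) c ≡ landing s c
  landing-push s a c ica = maxOver-cong k unchanged
    where
      unchanged : ∀ d → barrier (push s a) c d ≡ barrier s c d
      unchanged d with I c d in icd
      ... | true = refl
      ... | false = cong next (push-other s a d d≢a)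
        where
          d≢a : d ≢ a
          d≢a refl with () ← trans (sym ica) icd

  push-cong : ∀ {s s'} c → s ≗ s' → push s c ≗ push s' c
  push-cong {s} {s'} c e d with d F.≟ c
  ... | yes refl = trans (push-at s d) (trans (cong₂ _∷_ (landing-cong d e) (e d)) (sym (push-at s' d)))
  ... | no d≢c = trans (push-other s c d d≢c) (trans (e d) (sym (push-other s' c d d≢c)))

  stack-cong : ∀ {s s'} w → s ≗ s' → stack s w ≗ stack s' w
  stack-cong [] e = e
  stack-cong (c ∷ w) e = stack-cong w (push-cong c e)

  push-comm : ∀ s a b → I a b ≡ true → push (push s a) b ≗ push (push s b) a
  push-comm s a b iab d with d F.≟ a | d F.≟ b
  ... | yes refl | yes refl = ⊥-elim (I-true⇒≢ iab refl)
  ... | yes refl | no d≢b = begin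
      push (push s d) b d            ≡⟨ push-other (push s d) b d d≢b ⟩
      push s d d                     ≡⟨ push-at s d ⟩
      landing s d ∷ s d              ≡⟨ cong₂ _∷_ (sym (landing-push s b d iab)) (sym (push-other s b d d≢b)) ⟩
      landing (push s b) d ∷ push s b d  ≡⟨ sym (push-at (push s b) d) ⟩
      push (push s b) d d            ∎
    where open ≡-Reasoning
  ... | no d≢a | yes refl = begin
      push (push s a) d d            ≡⟨ push-at (push s a) d ⟩
      landing (push s a) d ∷ push s a d  ≡⟨ cong₂ _∷_ (landing-push s a d (I-sym a d iab)) (push-other s a d d≢a) ⟩
      landing s d ∷ s d              ≡⟨ sym (push-at s d) ⟩
      push s d d                     ≡⟨ sym (push-other (push s d) a d d≢a) ⟩
      push (push s d) a d            ∎
    where open ≡-Reasoning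
  ... | no d≢a | no d≢b =
    trans (push-other (push s a) b d d≢b) (trans (push-other s a d d≢a)
      (sym (trans (push-other (push s b) a d d≢a) (push-other s b d d≢b))))

  stack-∼ : ∀ {u v} → u ∼ v → ∀ s → stack s u ≗ stack s v
  stack-∼ ≈-refl s d = refl
  stack-∼ (≈-sym e) s d = sym (stack-∼ e s d)
  stack-∼ (≈-trans e f) s d = trans (stack-∼ e s d) (stack-∼ f s d)
  stack-∼ (≈-swap u v a b iab) s d
    rewrite stack-++ s u (a ∷ b ∷ v) | stack-++ s u (b ∷ a ∷ v) =
    stack-cong v (push-comm (stack s u) a b iab) d

  push-keeps : ∀ s c d {j} → j ∈ₗ s d → j ∈ₗ push s c d
  push-keeps s c d m with d F.≟ c
  ... | yes refl = subst (_ ∈ₗ_) (sym (push-at s d)) (there m)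
  ... | no d≢c = subst (_ ∈ₗ_) (sym (push-other s c d d≢c)) m

  stack-keeps : ∀ w s d {j} → j ∈ₗ s d → j ∈ₗ stack s w d
  stack-keeps [] s d m = m
  stack-keeps (c ∷ w) s d m = stack-keeps w (push s c) d (push-keeps s c d m)

  next≤landing : ∀ s c → next (s c) ≤ landing s c
  next≤landing s c = landing-≥ s c c (I-irrefl c)

  next-push : ∀ s c d → next (s d) ≤ next (push s c d)
  next-push s c d with d F.≟ c
  ... | yes refl rewrite push-at s d = NP.m≤n⇒m≤1+n (next≤landing s d)
  ... | no d≢c rewrite push-other s c d d≢c = NP.≤-refl

  Sorted : Levels → Set
  Sorted s = ∀ d {j} → j ∈ₗ s d → j < next (s d)

  push-sorted : ∀ s c → Sorted s → Sorted (push s c)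
  push-sorted s c sorted d m with d F.≟ c
  ... | yes refl rewrite push-at s d with m
  ...   | here refl = NP.≤-refl
  ...   | there m' = NP.m≤n⇒m≤1+n (NP.<-≤-trans (sorted d m') (next≤landing s d))
  push-sorted s c sorted d m | no d≢c rewrite push-other s c d d≢c = sorted d m

  stack-sorted : ∀ w s → Sorted s → Sorted (stack s w)
  stack-sorted [] s sorted = sorted
  stack-sorted (c ∷ w) s sorted = stack-sorted w (push s c) (push-sorted s c sorted)

  push-pinned : ∀ s e c d {j} → I c d ≡ false → j < next (s d) → j ∈ₗ push s e c → j ∈ₗ s c
  push-pinned s e c d icd j< m with c F.≟ e
  ... | no c≢e = subst (_ ∈ₗ_) (push-other s e c c≢e) m
  ... | yes refl rewrite push-at s c with m
  ...   | here refl = ⊥-elim (NP.<-irrefl refl (NP.<-≤-trans j< (landing-≥ s c d icd)))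
  ...   | there m' = m'

  stack-pinned : ∀ w s c d {j} → I c d ≡ false → j < next (s d) → j ∈ₗ stack s w c → j ∈ₗ s c
  stack-pinned [] s c d icd j< m = m
  stack-pinned (e ∷ w) s c d icd j< m =
    push-pinned s e c d icd j<
      (stack-pinned w (push s e) c d icd (NP.<-≤-trans j< (next-push s e d)) m)

  record Layer (s : Levels) (L : Word H) (h : ℕ) : Set where
    field
      unique      : Unique L
      independent : Independent L
      lands       : ∀ {c} → c ∈ₗ L → landing s c ≡ h

  layer-tail : ∀ {s c L h} → Layer s (c ∷ L) h → Layer (push s c) L h
  layer-tail {s} {c} record { unique = c∉L ∷ uL ; independent = ind ; lands = lands } = record
    { unique = uL
    ; independent = λ m m' → ind (there m) (there m')
    ; lands = λ {c'} m → trans (landing-push s c c' (ind (there m) (here refl) (λ e → All.lookup c∉L m (sym e))))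
                               (lands (there m))
    }

  stack-layer-∉ : ∀ {s L h} → Layer s L h → ∀ d → d ∉ₗ L → stack s L d ≡ s d
  stack-layer-∉ {s} {[]} lay d d∉ = refl
  stack-layer-∉ {s} {c ∷ L} lay d d∉ =
    trans (stack-layer-∉ (layer-tail lay) d (λ m → d∉ (there m)))
          (push-other s c d (λ e → d∉ (here e)))

  stack-layer-∈ : ∀ {s L h} → Layer s L h → ∀ d → d ∈ₗ L → stack s L d ≡ h ∷ s d
  stack-layer-∈ {s} {c ∷ L} lay d (here refl) = begin
    stack (push s d) L d   ≡⟨ stack-layer-∉ (layer-tail lay) d (λ m → All.lookup d∉L m refl) ⟩
    push s d d             ≡⟨ push-at s d ⟩
    landing s d ∷ s d      ≡⟨ cong (_∷ s d) (Layer.lands lay (here refl)) ⟩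
    _ ∷ s d                ∎
    where
      open ≡-Reasoning
      d∉L = proj₁ (uncons (Layer.unique lay))
  stack-layer-∈ {s} {c ∷ L} lay d (there m) =
    trans (stack-layer-∈ (layer-tail lay) d m)
          (cong (_ ∷_) (push-other s c d (λ { refl → All.lookup d∉L m refl })))
    where d∉L = proj₁ (uncons (Layer.unique lay))

  -- The levels of the prefix γ₁ ⋯ γₙ of a path x in (𝒞 , →) are exactly its
  -- clique positions: a piece d occurs at level j iff j < n and d ∈ γ_{j+1}.
  -- This is where the Cartier–Foata condition γ_j → γ_{j+1} is used.
  record Profile (x : MBar H) (n : ℕ) (s : Levels) : Set where
    field
      bounded : ∀ d → next (s d) ≤ n
      levels⁺ : ∀ {d j} → j < n → d ∈ set (seq x j) → j ∈ₗ s d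
      levels⁻ : ∀ {d j} → j ∈ₗ s d → j < n × d ∈ set (seq x j)
      sorted  : Sorted s
  open Profile

  -- Every piece of γ_{n+1} lands exactly at level n: not lower because it
  -- depends on some piece of γ_n, not higher because all of γ₁ ⋯ γₙ is below n.
  profile-landing : ∀ {x n s c} → Profile x n s → c ∈ set (seq x n) → landing s c ≡ n
  profile-landing {x} {zero} {s} {c} p c∈ = NP.n≤0⇒n≡0 (landing-≤ s c (bounded p))
  profile-landing {x} {suc m} {s} {c} p c∈ with chain x m c c∈
  ... | e , e∈ , iec = NP.≤-antisym (landing-≤ s c (bounded p))
      (NP.≤-trans (sorted p e (levels⁺ p NP.≤-refl e∈)) (landing-≥ s c e (I-false-sym e c iec)))

  profile-step : ∀ {x n s} → Profile x n s → Profile x (suc n) (stack s (cliqueWord H (seq x n)))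
  profile-step {x} {n} {s} p = record
    { bounded = bounded′ ; levels⁺ = levels⁺′ ; levels⁻ = levels⁻′
    ; sorted = stack-sorted L s (sorted p) }
    where
      γ = seq x n
      L = cliqueWord H γ
      lay : Layer s L n
      lay = record { unique = subsetWord-unique (set γ) ; independent = cliqueWord-independent γ
                   ; lands = λ m → profile-landing p (subsetWord-∈⁻ (set γ) m) }
      added : ∀ {d} → d ∈ set γ → stack s L d ≡ n ∷ s d
      added d∈ = stack-layer-∈ lay _ (subsetWord-∈⁺ d∈)
      untouched : ∀ {d} → d ∉ set γ → stack s L d ≡ s d
      untouched d∉ = stack-layer-∉ lay _ (λ m → d∉ (subsetWord-∈⁻ (set γ) m))
      bounded′ : ∀ d → next (stack s L d) ≤ suc n
      bounded′ d with d SP.∈? set γ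
      ... | yes d∈ rewrite added d∈ = NP.≤-refl
      ... | no d∉ rewrite untouched d∉ = NP.m≤n⇒m≤1+n (bounded p d)
      levels⁺′ : ∀ {d j} → j < suc n → d ∈ set (seq x j) → j ∈ₗ stack s L d
      levels⁺′ {d} (s≤s j≤n) d∈ with NP.m≤n⇒m<n∨m≡n j≤n
      ... | inj₁ j<n = stack-keeps L s d (levels⁺ p j<n d∈)
      ... | inj₂ refl = subst (_ ∈ₗ_) (sym (added d∈)) (here refl)
      below : ∀ {d j} → j < n × d ∈ set (seq x j) → j < suc n × d ∈ set (seq x j)
      below (j<n , d∈) = NP.m≤n⇒m≤1+n j<n , d∈
      levels⁻′ : ∀ {d j} → j ∈ₗ stack s L d → j < suc n × d ∈ set (seq x j)
      levels⁻′ {d} m with d SP.∈? set γ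
      ... | no d∉ = below (levels⁻ p (subst (_ ∈ₗ_) (untouched d∉) m))
      ... | yes d∈ with subst (_ ∈ₗ_) (added d∈) m
      ...   | here refl = NP.≤-refl , d∈
      ...   | there m' = below (levels⁻ p m')

  profile-prefix : ∀ x n → Profile x n (stack empty (prefix H n x))
  profile-prefix x zero = record
    { bounded = λ _ → z≤n ; levels⁺ = λ () ; levels⁻ = λ () ; sorted = λ _ () }
  profile-prefix x (suc n) rewrite stack-++ empty (prefix H n x) (cliqueWord H (seq x n)) =
    profile-step (profile-prefix x n)

  infix 4 _≤ʷ_

  _≤ʷ_ : Word H → Word H → Set
  _≤ʷ_ = _≤ᴹ_ H

  prefix-≤-stack : ∀ n x y → prefix H n x ≤ʷ prefix H n y →
                   ∃ λ z → stack empty (prefix H n y) ≗ stack (stack empty (prefix H n x)) z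
  prefix-≤-stack n x y (z , e) =
    z , λ d → trans (stack-∼ e empty d) (cong (λ t → t d) (stack-++ empty (prefix H n x) z))

  levelwise-⊆ : ∀ {n x y j} → prefix H n x ≤ʷ prefix H n y → j < n → set (seq x j) ⊆ set (seq y j)
  levelwise-⊆ {n} {x} {y} le j<n {c} c∈ with prefix-≤-stack n x y le
  ... | z , eq = proj₂ (levels⁻ (profile-prefix y n)
      (subst (_ ∈ₗ_) (sym (eq c)) (stack-keeps z _ c (levels⁺ (profile-prefix x n) j<n c∈))))

  pinned : ∀ {n x y l d c j} → prefix H n x ≤ʷ prefix H n y → l < n → d ∈ set (seq x l) →
           I c d ≡ false → j ≤ l → c ∈ set (seq y j) → c ∈ set (seq x j)
  pinned {n} {x} {y} {l} {d} {c} {j} le l<n d∈ icd j≤l c∈y with prefix-≤-stack n x y le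
  ... | z , eq = proj₂ (levels⁻ px (stack-pinned z _ c d icd j<next
      (subst (_ ∈ₗ_) (eq c) (levels⁺ (profile-prefix y n) j<n c∈y))))
    where
      px = profile-prefix x n
      j<n = NP.≤-<-trans j≤l l<n
      j<next : j < next (stack empty (prefix H n x) d)
      j<next = NP.≤-<-trans j≤l (sorted px d (levels⁺ px l<n d∈))

  infix 4 _≅_ _⊑_

  _≅_ : MBar H → MBar H → Set
  _≅_ = _≐_ H

  _⊑_ : MBar H → MBar H → Set
  _⊑_ = _≤̄_ H

  prefix-cong : ∀ {x y} → x ≅ y → ∀ n → prefix H n x ≡ prefix H n y
  prefix-cong e zero = refl
  prefix-cong e (suc n) = cong₂ _++_ (prefix-cong e n) (cong (subsetWord H) (e n))

  ⊑-resp : ∀ {x x' y y'} → x ≅ x' → y ≅ y' → x ⊑ y → x' ⊑ y'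
  ⊑-resp ex ey le n = subst₂ _≤ʷ_ (prefix-cong ex n) (prefix-cong ey n) (le n)

  ⊑-refl : ∀ {x} → x ⊑ x
  ⊑-refl n = [] , ∼-reflexive (sym (LP.++-identityʳ _))

  ⊑-antisym : ∀ {x y} → x ⊑ y → y ⊑ x → x ≅ y
  ⊑-antisym {x} {y} x⊑y y⊑x j = SP.⊆-antisym (levelwise-⊆ {x = x} {y} (x⊑y (suc j)) NP.≤-refl)
                                             (levelwise-⊆ {x = y} {x} (y⊑x (suc j)) NP.≤-refl)

  prefix-≤ : ∀ x {i n} → i ≤ n → prefix H i x ≤ʷ prefix H n x
  prefix-≤ x i≤n = extend (NP.≤⇒≤′ i≤n)
    where
      extend : ∀ {i n} → i N.≤′ n → prefix H i x ≤ʷ prefix H n x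
      extend N.≤′-refl = [] , ∼-reflexive (sym (LP.++-identityʳ _))
      extend {i} (N.≤′-step {n} i≤′n) with extend i≤′n
      ... | z , e = z ++ cliqueWord H (seq x n) ,
                    ≈-trans (∼-congʳ (cliqueWord H (seq x n)) e)
                            (∼-reflexive (LP.++-assoc (prefix H i x) z _))

  truncSeq-below : ∀ m f j → j < m → truncSeq H m f j ≡ f j
  truncSeq-below (suc m) f zero _ = refl
  truncSeq-below (suc m) f (suc j) (s≤s j<m) = truncSeq-below m (λ i → f (suc i)) j j<m

  truncSeq-above : ∀ m f j → m ≤ j → truncSeq H m f j ≡ emptyClique H
  truncSeq-above zero f j _ = refl
  truncSeq-above (suc m) f (suc j) (s≤s m≤j) = truncSeq-above m (λ i → f (suc i)) j m≤j

  prefix-truncate : ∀ m x n → prefix H n (truncate H m x) ≡ prefix H (n ⊓ m) x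
  prefix-truncate m x zero = refl
  prefix-truncate m x (suc n) with n N.<? m
  ... | yes n<m = begin
      prefix H n (truncate H m x) ++ cliqueWord H (truncSeq H m (seq x) n)
        ≡⟨ cong₂ _++_ (prefix-truncate m x n) (cong (cliqueWord H) (truncSeq-below m (seq x) n n<m)) ⟩
      prefix H (n ⊓ m) x ++ cliqueWord H (seq x n)
        ≡⟨ cong (λ i → prefix H i x ++ cliqueWord H (seq x n)) (NP.m≤n⇒m⊓n≡m (NP.<⇒≤ n<m)) ⟩
      prefix H (suc n) x
        ≡⟨ cong (λ i → prefix H i x) (sym (NP.m≤n⇒m⊓n≡m n<m)) ⟩
      prefix H (suc n ⊓ m) x ∎
    where open ≡-Reasoning
  ... | no n≮m = begin
      prefix H n (truncate H m x) ++ cliqueWord H (truncSeq H m (seq x) n)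
        ≡⟨ cong₂ _++_ (prefix-truncate m x n)
                      (trans (cong (cliqueWord H) (truncSeq-above m (seq x) n m≤n)) subsetWord-⊥) ⟩
      prefix H (n ⊓ m) x ++ []
        ≡⟨ LP.++-identityʳ _ ⟩
      prefix H (n ⊓ m) x
        ≡⟨ cong (λ i → prefix H i x) (trans (NP.m≥n⇒m⊓n≡n m≤n) (sym (NP.m≥n⇒m⊓n≡n (NP.m≤n⇒m≤1+n m≤n)))) ⟩
      prefix H (suc n ⊓ m) x ∎
    where
      open ≡-Reasoning
      m≤n = NP.≮⇒≥ n≮m

  truncate-cong : ∀ m {x y} → (∀ j → j < m → set (seq x j) ≡ set (seq y j)) →
                  truncate H m x ≅ truncate H m y
  truncate-cong m {x} {y} agree j with j N.<? m
  ... | yes j<m = trans (cong set (truncSeq-below m (seq x) j j<m))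
                        (trans (agree j j<m) (cong set (sym (truncSeq-below m (seq y) j j<m))))
  ... | no j≮m = trans (cong set (truncSeq-above m (seq x) j (NP.≮⇒≥ j≮m)))
                       (cong set (sym (truncSeq-above m (seq y) j (NP.≮⇒≥ j≮m))))

  ∂M-infinite : ∀ (ξ : ∂M H) → ¬ Finite H (elt ξ)
  ∂M-infinite ξ (N , vanish) with nonempty ξ N
  ... | c , c∈ = SP.∉⊥ (subst (c ∈_) (vanish N NP.≤-refl) c∈)

  ∼-setoid : Setoid _ _
  ∼-setoid = record
    { Carrier = Word H ; _≈_ = _∼_
    ; isEquivalence = record { refl = ≈-refl ; sym = ≈-sym ; trans = ≈-trans } }

  -- Commutation criterion for w ⊑ x: each clique of w is contained in the
  -- corresponding clique of x, and every extra piece of x is independent of all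
  -- pieces of w at higher levels, so the extra pieces commute out of the way.
  ⊑-by-commutation : ∀ (w x : MBar H) → (∀ j → set (seq w j) ⊆ set (seq x j)) →
    (∀ {j l c d} → j < l → c ∈ set (seq x j) → c ∉ set (seq w j) → d ∈ set (seq w l) → I c d ≡ true) →
    w ⊑ x
  ⊑-by-commutation w x sub extra-indep n = proj₁ (decompose n) , proj₁ (proj₂ (decompose n))
    where
      Extra : ℕ → Fin k → Set
      Extra n c = ∃ λ j → j < n × c ∈ set (seq x j) × c ∉ set (seq w j)

      decompose : ∀ n → ∃ λ r → prefix H n x ∼ prefix H n w ++ r × All (Extra n) r
      decompose zero = [] , ≈-refl , []
      decompose (suc n) with decompose n
      ... | r , e , extra = r ++ G , equation , AllP.++⁺ (All.map lift extra) (All.tabulate extra-G)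
        where
          X = cliqueWord H (seq x n)
          W = cliqueWord H (seq w n)
          inW? = SP._∈? set (seq w n)
          G = filter (∁? inW?) X
          split : X ∼ W ++ G
          split = subst (λ F → X ∼ F ++ G) (subsetWord-⊆ (sub n))
                        (partition inW? X (cliqueWord-independent (seq x n)))
          r-indep : All (λ c → All (λ d → I d c ≡ true) r) W
          r-indep = All.tabulate λ c∈W → All.map (λ { (j , j<n , d∈ , d∉) →
                      extra-indep j<n d∈ d∉ (subsetWord-∈⁻ (set (seq w n)) c∈W) }) extra
          pw = prefix H n w
          equation : prefix H n x ++ X ∼ (pw ++ W) ++ (r ++ G)
          equation = begin
            prefix H n x ++ X    ≈⟨ ∼-congʳ X e ⟩
            (pw ++ r) ++ X       ≈⟨ ∼-congˡ (pw ++ r) split ⟩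
            (pw ++ r) ++ W ++ G  ≡⟨ trans (LP.++-assoc pw r (W ++ G)) (cong (pw ++_) (sym (LP.++-assoc r W G))) ⟩
            pw ++ (r ++ W) ++ G  ≈⟨ ∼-congˡ pw (∼-congʳ G (commute r W r-indep)) ⟩
            pw ++ (W ++ r) ++ G  ≡⟨ trans (cong (pw ++_) (LP.++-assoc W r G)) (sym (LP.++-assoc pw W (r ++ G))) ⟩
            (pw ++ W) ++ r ++ G  ∎
            where open SetoidReasoning ∼-setoid
          lift : ∀ {c} → Extra n c → Extra (suc n) c
          lift (j , j<n , c∈ , c∉) = j , NP.m≤n⇒m≤1+n j<n , c∈ , c∉
          extra-G : ∀ {c} → c ∈ₗ G → Extra (suc n) c
          extra-G m with LMP.∈-filter⁻ (∁? inW?) m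
          ... | c∈X , c∉W = n , NP.≤-refl , subsetWord-∈⁻ (set (seq x n)) c∈X , c∉W

  ≅-dec : ∀ (x y : MBar H) n → Dec (set (seq x n) ≡ set (seq y n))
  ≅-dec x y n = VP.≡-dec BP._≟_ (set (seq x n)) (set (seq y n))

  finite-resp : ∀ {x y} → x ≅ y → Finite H x → Finite H y
  finite-resp e (N , vanish) = N , λ m N≤m → trans (sym (e m)) (vanish m N≤m)

  -- v agrees up to level n with some prefix of x of length ≤ n (a decidable property).
  CutAt : ℕ → MBar H → MBar H → Set
  CutAt n v x = ∃ λ (i : Fin (suc n)) → prefix H n v ≡ prefix H (F.toℕ i) x

  cut? : ∀ n v x → Dec (CutAt n v x)
  cut? n v x = FP.any? (λ i → LP.≡-dec F._≟_ (prefix H n v) (prefix H (F.toℕ i) x))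

  cut-at : ∀ {n v x} i → i ≤ n → prefix H n v ≡ prefix H i x → CutAt n v x
  cut-at {n} {v} {x} i i≤n e =
    F.fromℕ< (s≤s i≤n) , trans e (cong (λ j → prefix H j x) (sym (FP.toℕ-fromℕ< (s≤s i≤n))))

  cut⇒≤ : ∀ {n v x} → CutAt n v x → prefix H n v ≤ʷ prefix H n x
  cut⇒≤ {n} {v} {x} (i , e) = subst (_≤ʷ prefix H n x) (sym e) (prefix-≤ x (FP.toℕ≤pred[n] i))

  adjoin : ∀ (γ : Clique H) c → (∀ d → d ∈ set γ → I c d ≡ true) → Clique H
  adjoin γ c indep-c = record { set = set γ ∪ ⁅ c ⁆ ; indep = indep′ }
    where
      indep′ : ∀ a b → a ∈ set γ ∪ ⁅ c ⁆ → b ∈ set γ ∪ ⁅ c ⁆ → a ≢ b → I a b ≡ true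
      indep′ a b a∈ b∈ a≢b with SP.x∈p∪q⁻ (set γ) ⁅ c ⁆ a∈ | SP.x∈p∪q⁻ (set γ) ⁅ c ⁆ b∈
      ... | inj₁ a∈γ | inj₁ b∈γ = indep γ a b a∈γ b∈γ a≢b
      ... | inj₁ a∈γ | inj₂ b∈c rewrite SP.x∈⁅y⁆⇒x≡y c b∈c = I-sym c a (indep-c a a∈γ)
      ... | inj₂ a∈c | inj₁ b∈γ rewrite SP.x∈⁅y⁆⇒x≡y c a∈c = indep-c b b∈γ
      ... | inj₂ a∈c | inj₂ b∈c =
        ⊥-elim (a≢b (trans (SP.x∈⁅y⁆⇒x≡y c a∈c) (sym (SP.x∈⁅y⁆⇒x≡y c b∈c))))

  maximal-dependent : ∀ γ → MaximalClique H γ → ∀ c → ∃ λ d → d ∈ set γ × I c d ≡ false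
  maximal-dependent γ max c with FP.any? (λ d → (d SP.∈? set γ) ×-dec (I c d BP.≟ false))
  ... | yes found = found
  ... | no none = ⊥-elim (none (c , c∈γ , I-irrefl c))
    where
      indep-c : ∀ d → d ∈ set γ → I c d ≡ true
      indep-c d d∈ with I c d in icd
      ... | true = refl
      ... | false = ⊥-elim (none (d , d∈ , icd))
      c∈γ : c ∈ set γ
      c∈γ = subst (c ∈_) (max (adjoin γ c indep-c) (SP.p⊆p∪q ⁅ c ⁆)) (SP.x∈p∪q⁺ (inj₂ (SP.x∈⁅x⁆ c)))

  maximal-resp : ∀ {γ δ} → set γ ≡ set δ → MaximalClique H γ → MaximalClique H δ
  maximal-resp {γ} {δ} e max γ' δ⊆γ' = trans (max γ' (λ {x} x∈γ → δ⊆γ' (subst (x ∈_) e x∈γ))) e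

  -- If the prefix of x ending with a maximal clique γ_{m+1} is below the
  -- corresponding prefix of y, then x and y agree up to level m: every
  -- piece depends on γ_{m+1}, so y can have no further pieces below it.
  agree-below-maximal : ∀ {m x y} → prefix H (suc m) x ≤ʷ prefix H (suc m) y →
                        MaximalClique H (seq x m) → ∀ j → j ≤ m → set (seq x j) ≡ set (seq y j)
  agree-below-maximal {m} {x} {y} le max j j≤m =
    SP.⊆-antisym (levelwise-⊆ {x = x} {y} le (s≤s j≤m))
                 (λ {c} c∈y → let (d , d∈ , icd) = maximal-dependent (seq x m) max c
                              in pinned {x = x} {y} le NP.≤-refl d∈ icd j≤m c∈y)

  first-maximal-is-AST : ∀ V → Spec1 H V → IsAST H V
  first-maximal-is-AST V spec = below , stops
    where
      Maximal-at : ∂M H → ℕ → Set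
      Maximal-at ξ m = MaximalClique H (seq (elt ξ) m)

      -- ξ_V is a truncation of ξ or ξ itself, so at each level a cut of ξ
      below : ∀ ξ → V ξ ⊑ elt ξ
      below ξ n = cut⇒≤ (by-first-or-none (Maximal-at ξ) (cut? n (V ξ) (elt ξ)) cut)
        where
          cut : FirstOrNone (Maximal-at ξ) → CutAt n (V ξ) (elt ξ)
          cut (inj₁ (m , max , before)) =
            cut-at (n ⊓ suc m) (NP.m⊓n≤m n (suc m))
                   (trans (prefix-cong (proj₁ (spec ξ) m max before) n) (prefix-truncate (suc m) (elt ξ) n))
          cut (inj₂ none) = cut-at n NP.≤-refl (prefix-cong (proj₂ (spec ξ) none) n)

      stops : ∀ ξ ξ' → Finite H (V ξ) → V ξ ⊑ elt ξ' → V ξ' ≅ V ξ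
      stops ξ ξ' fin le n = by-first-or-none (Maximal-at ξ) (≅-dec (V ξ') (V ξ) n) (λ c → same c n)
        where
          -- without a maximal clique ξ_V = ξ would be infinite; otherwise ξ' agrees
          -- with ξ up to its first maximal clique, which is then also the first of ξ'
          same : FirstOrNone (Maximal-at ξ) → V ξ' ≅ V ξ
          same (inj₂ none) = ⊥-elim (∂M-infinite ξ (finite-resp {V ξ} {elt ξ} (proj₂ (spec ξ) none) fin))
          same (inj₁ (m , max , before)) =
            λ j → trans (proj₁ (spec ξ') m max′ before′ j)
                        (trans (truncate-cong (suc m) {elt ξ'} {elt ξ} (λ i i<m → sym (agree i (NP.≤-pred i<m))) j)
                               (sym (Vξ≅ j)))
            where
              Vξ≅ = proj₁ (spec ξ) m max before
              prefix≤ : prefix H (suc m) (elt ξ) ≤ʷ prefix H (suc m) (elt ξ')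
              prefix≤ = subst (_≤ʷ prefix H (suc m) (elt ξ'))
                              (trans (prefix-cong Vξ≅ (suc m))
                                     (trans (prefix-truncate (suc m) (elt ξ) (suc m))
                                            (cong (λ i → prefix H i (elt ξ)) (NP.m≤n⇒m⊓n≡m NP.≤-refl))))
                              (le (suc m))
              agree = agree-below-maximal {x = elt ξ} {elt ξ'} prefix≤ max
              max′ : Maximal-at ξ' m
              max′ = maximal-resp {seq (elt ξ) m} {seq (elt ξ') m} (agree m NP.≤-refl) max
              before′ : ∀ j → j < m → ¬ Maximal-at ξ' j
              before′ j j<m max-j = before j j<m (maximal-resp {seq (elt ξ') j} {seq (elt ξ) j} (sym (agree j (NP.<⇒≤ j<m))) max-j)

  select : ∀ {P : Fin k → Set} → Decidable P → Subset k
  select P? = V.tabulate (λ c → does (P? c))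

  select-∈⁺ : ∀ {P : Fin k → Set} (P? : Decidable P) {c} → P c → c ∈ select P?
  select-∈⁺ P? {c} Pc = VP.lookup⇒[]= c _ (trans (VP.lookup∘tabulate _ c) (dec-true (P? c) Pc))

  select-∈⁻ : ∀ {P : Fin k → Set} (P? : Decidable P) {c} → c ∈ select P? → P c
  select-∈⁻ P? {c} c∈ with P? c | trans (sym (VP.lookup∘tabulate (λ c → does (P? c)) c)) (VP.[]=⇒lookup c∈)
  ... | yes Pc | _ = Pc
  ... | no _ | ()

  -- Downward closure of a layer T at level h inside a family f of cliques:
  -- going down level by level, keep the pieces of f j that depend on a piece
  -- kept above.  S accumulates the pieces kept at levels ≥ h.
  module Downset (f : ℕ → Subset k) where

    DependsOn : Subset k → Fin k → Set
    DependsOn S c = ∃ λ d → d ∈ S × I c d ≡ false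

    dependent? : ∀ j S → Decidable (λ c → c ∈ f j × DependsOn S c)
    dependent? j S c = (c SP.∈? f j) ×-dec FP.any? (λ d → (d SP.∈? S) ×-dec (I c d BP.≟ false))

    dependents : ℕ → Subset k → Subset k
    dependents j S = select (dependent? j S)

    dependents-∈⁺ : ∀ {j S c d} → c ∈ f j → d ∈ S → I c d ≡ false → c ∈ dependents j S
    dependents-∈⁺ {j} {S} {c} {d} c∈ d∈ icd = select-∈⁺ (dependent? j S) (c∈ , d , d∈ , icd)

    dependents-∈⁻ : ∀ {j S c} → c ∈ dependents j S → c ∈ f j × DependsOn S c
    dependents-∈⁻ {j} {S} = select-∈⁻ (dependent? j S)

    -- down h S T j: T is the layer kept at level h and S ⊇ T all pieces kept at
    -- levels ≥ h; the result is the layer kept at level j.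
    down : ℕ → Subset k → Subset k → ℕ → Subset k
    down zero S T zero = T
    down zero S T (suc j) = ⊥
    down (suc h) S T j with j N.≟ suc h
    ... | yes _ = T
    ... | no _ = down h (S ∪ dependents h S) (dependents h S) j

    down-top : ∀ h S T → down h S T h ≡ T
    down-top zero S T = refl
    down-top (suc h) S T with suc h N.≟ suc h
    ... | yes _ = refl
    ... | no h≢h = ⊥-elim (h≢h refl)

    down-above : ∀ h S T j → h < j → down h S T j ≡ ⊥
    down-above zero S T (suc j) _ = refl
    down-above (suc h) S T j h<j with j N.≟ suc h
    ... | yes refl = ⊥-elim (NP.<-irrefl refl h<j)
    ... | no _ = down-above h _ _ j (NP.<-trans (NP.n<1+n h) h<j)

    down-step : ∀ h S T j → j ≤ h → down (suc h) S T j ≡ down h (S ∪ dependents h S) (dependents h S) j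
    down-step h S T j j≤h with j N.≟ suc h
    ... | yes refl = ⊥-elim (NP.<-irrefl refl (s≤s j≤h))
    ... | no _ = refl

    down-⊆ : ∀ h S T → T ⊆ f h → ∀ j → down h S T j ⊆ f j
    down-⊆ zero S T T⊆ zero c∈ = T⊆ c∈
    down-⊆ zero S T T⊆ (suc j) c∈ = ⊥-elim (SP.∉⊥ c∈)
    down-⊆ (suc h) S T T⊆ j c∈ with j N.≟ suc h
    ... | yes refl = T⊆ c∈
    ... | no _ = down-⊆ h _ _ (λ m → proj₁ (dependents-∈⁻ m)) j c∈

    down-seed : ∀ h S T {j c d} → j < h → c ∈ f j → d ∈ S → I c d ≡ false → c ∈ down h S T j
    down-seed (suc h) S T {j} j<h c∈ d∈ icd rewrite down-step h S T j (NP.≤-pred j<h)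
      with NP.m≤n⇒m<n∨m≡n (NP.≤-pred j<h)
    ... | inj₁ j<h′ = down-seed h _ _ j<h′ c∈ (SP.x∈p∪q⁺ (inj₁ d∈)) icd
    ... | inj₂ refl = subst (_ ∈_) (sym (down-top j _ _)) (dependents-∈⁺ c∈ d∈ icd)

    down-closed : ∀ h S T {j l c d} → T ⊆ S → j < l → l ≤ h → c ∈ f j →
                  d ∈ down h S T l → I c d ≡ false → c ∈ down h S T j
    down-closed zero S T T⊆S j<l z≤n c∈ d∈ icd = ⊥-elim (NP.n≮0 j<l)
    down-closed (suc h) S T {j} {l} T⊆S j<l l≤h c∈ d∈ icd with l N.≟ suc h
    ... | yes refl = down-seed (suc h) S T j<l c∈ (T⊆S d∈) icd
    ... | no l≢ rewrite down-step h S T j (NP.≤-pred (NP.<-≤-trans j<l l≤h)) =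
      down-closed h _ _ (SP.q⊆p∪q S _) j<l (NP.≤-pred (NP.≤∧≢⇒< l≤h l≢)) c∈ d∈ icd

    down-generated : ∀ h S T {j c} → j < h → c ∈ down h S T j →
                     ∃ λ d → I c d ≡ false × (d ∈ S ⊎ ∃ λ l → j < l × l ≤ h × d ∈ down h S T l)
    down-generated (suc h) S T {j} j<h c∈ rewrite down-step h S T j (NP.≤-pred j<h)
      with NP.m≤n⇒m<n∨m≡n (NP.≤-pred j<h)
    ... | inj₂ refl with dependents-∈⁻ (subst (_ ∈_) (down-top j _ _) c∈)
    ...   | _ , d , d∈S , icd = d , icd , inj₁ d∈S
    down-generated (suc h) S T {j} j<h c∈ | inj₁ j<h′ with down-generated h _ _ j<h′ c∈
    ... | d , icd , inj₂ (l , j<l , l≤h , d∈) = d , icd , inj₂ (l , j<l , NP.m≤n⇒m≤1+n l≤h , lift l≤h d∈)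
      where
        lift : ∀ {l d} → l ≤ h → d ∈ down h _ _ l → d ∈ down (suc h) S T l
        lift {l} l≤h d∈ = subst (_ ∈_) (sym (down-step h S T l l≤h)) d∈
    ... | d , icd , inj₁ d∈S∪D with SP.x∈p∪q⁻ S _ d∈S∪D
    ...   | inj₁ d∈S = d , icd , inj₁ d∈S
    ...   | inj₂ d∈D = d , icd , inj₂ (h , j<h′ , NP.n≤1+n h ,
              subst (_ ∈_) (sym (trans (down-step h S T h NP.≤-refl) (down-top h _ _))) d∈D)

  occ-∈⁻ : ∀ c L → 0 < occ H c L → c ∈ₗ L
  occ-∈⁻ c (b ∷ L) pos with c F.≟ b
  ... | yes refl = here refl
  ... | no _ = there (occ-∈⁻ c L pos)

  occ-∈⁺ : ∀ c L → c ∈ₗ L → 0 < occ H c L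
  occ-∈⁺ c (b ∷ L) m with c F.≟ b | m
  ... | yes _ | _ = s≤s z≤n
  ... | no c≢b | here c≡b = ⊥-elim (c≢b c≡b)
  ... | no _ | there m′ = occ-∈⁺ c L m′

  prefix-∈ : ∀ x N {c} → c ∈ₗ prefix H N x → ∃ λ j → c ∈ set (seq x j)
  prefix-∈ x (suc N) m with LMP.∈-++⁻ (prefix H N x) m
  ... | inj₁ m′ = prefix-∈ x N m′
  ... | inj₂ m′ = N , subsetWord-∈⁻ (set (seq x N)) m′

  contains-level : ∀ {a x} → Contains H a x → ∃ λ j → a ∈ set (seq x j)
  contains-level {a} {x} (N , pos) = prefix-∈ x N (occ-∈⁻ a _ pos)

  -- (2) The heap generated by the first occurrence of a in ξ, at level h: the
  -- pieces of ξ from which a chain of dependences leads up to that occurrence.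
  -- It is the least element of H_a(ξ'') for every ξ'' above it.
  module HittingHeap (ξ : MBar H) (a : Fin k) (h : ℕ)
                     (a∈ξ : a ∈ set (seq ξ h)) (first : ∀ j → j < h → a ∉ set (seq ξ j)) where
    open Downset (λ j → set (seq ξ j))

    layer : ℕ → Subset k
    layer = down h ⁅ a ⁆ ⁅ a ⁆

    layer-⊆ : ∀ j → layer j ⊆ set (seq ξ j)
    layer-⊆ = down-⊆ h ⁅ a ⁆ ⁅ a ⁆ (λ c∈ → subst (_∈ set (seq ξ h)) (sym (SP.x∈⁅y⁆⇒x≡y a c∈)) a∈ξ)

    a∈top : a ∈ layer h
    a∈top = subst (a ∈_) (sym (down-top h _ _)) (SP.x∈⁅x⁆ a)

    top-is-a : ∀ {c} → c ∈ layer h → c ≡ a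
    top-is-a c∈ = SP.x∈⁅y⁆⇒x≡y a (subst (_ ∈_) (down-top h _ _) c∈)

    above-empty : ∀ j → h < j → layer j ≡ ⊥
    above-empty = down-above h _ _

    downward : ∀ {j l c d} → j < l → c ∈ set (seq ξ j) → d ∈ layer l → I c d ≡ false → c ∈ layer j
    downward {l = l} {d = d} j<l c∈ d∈ icd with l N.≤? h
    ... | yes l≤h = down-closed h _ _ (λ m → m) j<l l≤h c∈ d∈ icd
    ... | no l≰h = ⊥-elim (SP.∉⊥ (subst (d ∈_) (above-empty l (NP.≰⇒> l≰h)) d∈))

    generated : ∀ {j c} → j < h → c ∈ layer j → ∃ λ l → j < l × l ≤ h × ∃ λ d → d ∈ layer l × I c d ≡ false
    generated j<h c∈ with down-generated h _ _ j<h c∈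
    ... | d , icd , inj₁ d∈a rewrite SP.x∈⁅y⁆⇒x≡y a d∈a = h , j<h , NP.≤-refl , a , a∈top , icd
    ... | d , icd , inj₂ (l , j<l , l≤h , d∈) = l , j<l , l≤h , d , d∈ , icd

    -- the generated heap itself, a path in (𝒞 , →) since dependence is passed down
    w : MBar H
    w = record { seq = clique ; chain = chain′ }
      where
        clique : ℕ → Clique H
        clique j = record { set = layer j
                          ; indep = λ b c b∈ c∈ → indep (seq ξ j) b c (layer-⊆ j b∈) (layer-⊆ j c∈) }
        chain′ : ∀ j → _⇝_ H (clique j) (clique (suc j))
        chain′ j b b∈ with chain ξ j b (layer-⊆ (suc j) b∈)
        ... | e , e∈ , ieb = e , downward NP.≤-refl e∈ b∈ ieb , ieb

    w-finite : Finite H w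
    w-finite = suc h , λ j h<j → above-empty j h<j

    w-contains : Contains H a w
    w-contains = suc h , occ-∈⁺ a _ (LMP.∈-++⁺ʳ (prefix H h w) (subsetWord-∈⁺ a∈top))

    -- a piece of ξ not kept at level j is independent of all kept pieces above j
    w⊑ξ : w ⊑ ξ
    w⊑ξ = ⊑-by-commutation w ξ layer-⊆ independent
      where
        independent : ∀ {j l c d} → j < l → c ∈ set (seq ξ j) → c ∉ layer j → d ∈ layer l → I c d ≡ true
        independent {c = c} {d} j<l c∈ c∉ d∈ with I c d in icd
        ... | true = refl
        ... | false = ⊥-elim (c∉ (downward j<l c∈ d∈ icd))

    w-lower : ∀ ξ'' → w ⊑ ξ'' → ∀ x → InH H a ξ'' x → w ⊑ x
    w-lower ξ'' w⊑ξ'' x (x⊑ξ'' , _ , contains) = ⊑-by-commutation w x kept independent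
      where
        in-ξ'' : ∀ {j c} → c ∈ layer j → c ∈ set (seq ξ'' j)
        in-ξ'' {j} = levelwise-⊆ {x = w} {ξ''} (w⊑ξ'' (suc j)) NP.≤-refl

        -- the a of x sits at level h: lower would contradict the choice of h,
        -- higher is impossible since a depends on itself
        a-at-h : a ∈ set (seq x h)
        a-at-h with contains-level {a} {x} contains
        ... | j , a∈x with NP.<-cmp j h
        ...   | tri< j<h _ _ = ⊥-elim (first j j<h (layer-⊆ j
                 (pinned {x = w} {ξ''} (w⊑ξ'' (suc h)) NP.≤-refl a∈top (I-irrefl a) (NP.<⇒≤ j<h)
                   (levelwise-⊆ {x = x} {ξ''} (x⊑ξ'' (suc j)) NP.≤-refl a∈x))))
        ...   | tri≈ _ refl _ = a∈x
        ...   | tri> _ _ h<j = pinned {x = x} {ξ''} (x⊑ξ'' (suc j)) NP.≤-refl a∈x (I-irrefl a) (NP.<⇒≤ h<j)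
                                 (in-ξ'' a∈top)

        -- by descending induction on the level (t bounds the distance to h)
        kept-from : ∀ t j → h ≤ t N.+ j → layer j ⊆ set (seq x j)
        kept-from t j h≤ {c} c∈ with NP.<-cmp j h
        ... | tri≈ _ refl _ = subst (_∈ set (seq x j)) (sym (top-is-a c∈)) a-at-h
        ... | tri> _ _ h<j = ⊥-elim (SP.∉⊥ (subst (c ∈_) (above-empty j h<j) c∈))
        ... | tri< j<h _ _ with t | generated j<h c∈
        ...   | zero | _ = ⊥-elim (NP.<⇒≱ j<h h≤)
        ...   | suc t′ | l , j<l , _ , d , d∈ , icd =
          pinned {x = x} {ξ''} (x⊑ξ'' (suc l)) NP.≤-refl
                 (kept-from t′ l (NP.≤-trans h≤ (NP.≤-trans (NP.≤-reflexive (sym (NP.+-suc t′ j)))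
                                                           (NP.+-monoʳ-≤ t′ j<l))) d∈)
                 icd (NP.<⇒≤ j<l) (in-ξ'' c∈)

        kept : ∀ j → layer j ⊆ set (seq x j)
        kept j = kept-from h j (NP.m≤m+n h j)

        independent : ∀ {j l c d} → j < l → c ∈ set (seq x j) → c ∉ layer j → d ∈ layer l → I c d ≡ true
        independent {j} {l} {c} {d} j<l c∈ c∉ d∈ with I c d in icd
        ... | true = refl
        ... | false = ⊥-elim (c∉ (pinned {x = w} {ξ''} (w⊑ξ'' (suc l)) NP.≤-refl d∈ icd (NP.<⇒≤ j<l)
                                    (levelwise-⊆ {x = x} {ξ''} (x⊑ξ'' (suc j)) NP.≤-refl c∈)))

    meet-is-w : ∀ ξ'' y → IsMeetH H a ξ'' y → w ⊑ ξ'' → y ≅ w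
    meet-is-w ξ'' y (_ , lower , greatest) w⊑ξ'' =
      ⊑-antisym {y} {w} (lower w (w⊑ξ'' , w-finite , w-contains)) (greatest w w⊑ξ'' (w-lower ξ'' w⊑ξ''))

  first-hit-is-AST : ∀ a V → Spec2 H a V → IsAST H V
  first-hit-is-AST a V spec = (λ ξ → proj₁ (spec ξ)) , stops
    where
      Hits : ∂M H → ℕ → Set
      Hits ξ j = a ∈ set (seq (elt ξ) j)

      stops : ∀ ξ ξ' → Finite H (V ξ) → V ξ ⊑ elt ξ' → V ξ' ≅ V ξ
      stops ξ ξ' fin le n = by-first-or-none (Hits ξ) (≅-dec (V ξ') (V ξ) n) (λ c → same c n)
        where
          same : FirstOrNone (Hits ξ) → V ξ' ≅ V ξ
          -- if a never occurs, H_a(ξ) is empty, so V ξ = ξ is infinite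
          same (inj₂ none) = ⊥-elim (∂M-infinite ξ (finite-resp {V ξ} {elt ξ} Vξ≅ξ fin))
            where
              vacuous : ∀ x → InH H a (elt ξ) x → elt ξ ⊑ x
              vacuous x (x⊑ξ , _ , contains) with contains-level {a} {x} contains
              ... | j , a∈x = ⊥-elim (none j (levelwise-⊆ {x = x} {elt ξ} (x⊑ξ (suc j)) NP.≤-refl a∈x))
              Vξ≅ξ : V ξ ≅ elt ξ
              Vξ≅ξ = ⊑-antisym {V ξ} {elt ξ} (proj₁ (spec ξ)) (proj₂ (proj₂ (spec ξ)) (elt ξ) ⊑-refl vacuous)
          -- otherwise both V ξ and V ξ' are the heap generated by the first a in ξ
          same (inj₁ (h , a∈ , before)) j = trans (Vξ'≅w j) (sym (Vξ≅w j))
            where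
              open HittingHeap (elt ξ) a h a∈ before
              Vξ≅w : V ξ ≅ w
              Vξ≅w = meet-is-w (elt ξ) (V ξ) (spec ξ) w⊑ξ
              Vξ'≅w : V ξ' ≅ w
              Vξ'≅w = meet-is-w (elt ξ') (V ξ') (spec ξ') (⊑-resp {V ξ} {w} Vξ≅w (λ _ → refl) le)

proposition2 : (H : HeapMonoid) →
    (∀ (V : ∂M H → MBar H) → Spec1 H V → IsAST H V)
    × (∀ (a : Fin (HeapMonoid.k H)) (V : ∂M H → MBar H) → Spec2 H a V → IsAST H V)
proposition2 H = first-maximal-is-AST H , first-hit-is-AST H
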